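{- Let $k\ge 2$ and let $N$ be a finite set with $|N|=n$ and $\log_2 n\ge k$. Let $p$ be the unique positive integer with $pk\le\lfloor\log_2 n\rfloor\le (p+1)k-1$, let $\mathcal{V}=\{v\in\mathbb{Z}_+^k\mid \sum_{i=1}^k v_i=pk-k+1\}$, and choose distinct elements $e_v\in N$ for $v\in\mathcal{V}$. For $i\in[k]$ let $N_i=\{e_v\mid v\in\mathcal{V},\ v_i\ge1\}$, $Z_i=\{e_v\mid v\in\mathcal{V},\ v_i=0\}$, and define $f_i:2^N\to\mathbb{R}$ by $f_i(S)=\max\{0,\max\{2p+1-v_i\mid e_v\in S\cap N_i\}\}$ if $S\cap N_i\ne\emptyset$ and $S\cap Z_i=\emptyset$; $f_i(S)=0$ if $S\cap N_i=\emptyset$ and $S\cap Z_i=\emptyset$; $f_i(S)=2pk+1$ if $S\cap Z_i\ne\emptyset$. Then for every partition $X_1,\ldots,X_k$ of $N$ (parts possibly empty), $\sum_{i=1}^k f_i(X_i)\ge pk+k$.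
   Context: $[k]=\{1,\ldots,k\}$; $\mathbb{Z}_+$ denotes the nonnegative integers. -}

module Defs where

open import Data.Nat using (ℕ; zero; suc; _+_; _*_; _∸_; _⊔_; _≡ᵇ_; _<ᵇ_)
open import Data.Bool using (Bool; true; false; _∧_; if_then_else_)
open import Data.Fin using (Fin)
import Data.Fin as F
open import Data.Vec using (Vec; []; _∷_; lookup)
import Data.Vec as V
open import Data.List using (List; []; _∷_; map; concatMap; upTo; filterᵇ; foldr; allFin)
open import Data.Bool.ListAction using (any)
open import Data.Nat.ListAction using (sum)
open import Relation.Nullary.Decidable using (⌊_⌋)
open import Relation.Binary.PropositionalEquality using (_≡_)

vsum : ∀ {k} → Vec ℕ k → ℕ
vsum = V.foldr _ _+_ 0

boundedVecs : (k b : ℕ) → List (Vec ℕ k)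
boundedVecs zero    b = [] ∷ []
boundedVecs (suc k) b = concatMap (λ x → map (x ∷_) (boundedVecs k b)) (upTo (suc b))

inV : ∀ {k} → ℕ → Vec ℕ k → Set
inV m v = vsum v ≡ m

𝒱 : (k m : ℕ) → List (Vec ℕ k)
𝒱 k m = filterᵇ (λ v → vsum v ≡ᵇ m) (boundedVecs k m)

-- Z_i-hit : S ∩ Z_i ≠ ∅ ;  N_i part: max{0, max{2p+1-v_i | e_v ∈ S ∩ N_i}},
-- where truncated subtraction ∸ realises max{0, ·} of the integer 2p+1-v_i.
f : (k p n : ℕ) (e : Vec ℕ k → Fin n) (i : Fin k) (S : Fin n → Bool) → ℕ
f k p n e i S =
  if any (λ v → S (e v) ∧ (lookup v i ≡ᵇ 0)) Vs
  then 2 * p * k + 1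
  else foldr _⊔_ 0
         (map (λ v → if S (e v) ∧ (0 <ᵇ lookup v i) then (2 * p + 1) ∸ lookup v i else 0) Vs)
  where
  Vs = 𝒱 k (p * k ∸ k + 1)

-- the part X_i = { x ∈ N | part x = i } of the partition given by part : N → [k]
part-at : ∀ {n k} → (Fin n → Fin k) → Fin k → (Fin n → Bool)
part-at part i x = ⌊ part x F.≟ i ⌋

total : (k p n : ℕ) (e : Vec ℕ k → Fin n) (part : Fin n → Fin k) → ℕ
total k p n e part = sum (map (λ i → f k p n e i (part-at part i)) (allFin k))

-- Consider the slack u_i = 2p ∸ f_i(X_i). If Σ u_i ≥ pk − k + 1 there is a v ∈ 𝒱 below u (fill the
-- coordinates greedily), and e_v lies in some part X_j. If v_j = 0 then X_j meets Z_j
-- and f_j(X_j) = 2pk + 1 alone is large enough; if v_j ≥ 1 then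
-- f_j(X_j) ≥ 2p + 1 − v_j ≥ 2p + 1 − u_j > f_j(X_j), which is absurd. Otherwise
-- Σ u_i ≤ pk − k, and Σ f_i(X_i) ≥ Σ (2p − u_i) ≥ 2pk − (pk − k) = pk + k.
module Submission where

open import Defs
open import Data.Nat using (ℕ; zero; suc; _+_; _*_; _∸_; _⊔_; _⊓_; _≡ᵇ_; _<ᵇ_; _≤_; _<_; z≤n; s≤s; _≤?_; >-nonZero)
open import Data.Nat.Properties
open import Data.Nat.Logarithm using (⌊log₂_⌋)
open import Data.Nat.ListAction using (sum)
open import Algebra.Properties.CommutativeSemigroup +-commutativeSemigroup using (interchange)
open import Data.Bool using (Bool; true; false; _∧_; if_then_else_; T)
open import Data.Bool.ListAction using (any)
open import Data.Fin using (Fin)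
import Data.Fin as F
open import Data.Fin.Properties using (nonZeroIndex)
open import Data.Vec using (Vec; []; _∷_; lookup)
import Data.Vec as V
open import Data.Vec.Properties using (lookup-map; lookup∘tabulate)
open import Data.List using (List; map; foldr)
import Data.List as L
open import Data.List.Relation.Unary.Any using (here; there)
import Data.List.Relation.Unary.Any as Any
open import Data.List.Relation.Unary.Any.Properties using (any⁺)
open import Data.List.Membership.Propositional using (_∈_; lose)
open import Data.List.Membership.Propositional.Properties
  using (∈-concatMap⁺; ∈-upTo⁺; ∈-map⁺; ∈-filter⁺)
open import Data.Product using (∃-syntax; _×_; _,_)
open import Relation.Nullary using (yes; no; contradiction)
open import Relation.Nullary.Decidable using (T?)
open import Relation.Binary.PropositionalEquality
  using (_≡_; refl; sym; trans; cong; cong₂; subst)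

∈⇒≤foldr⊔ : ∀ {A : Set} (g : A → ℕ) {x : A} {xs : List A} →
            x ∈ xs → g x ≤ foldr _⊔_ 0 (map g xs)
∈⇒≤foldr⊔ g {xs = y L.∷ _} (here refl) = m≤m⊔n (g y) _
∈⇒≤foldr⊔ g {xs = y L.∷ _} (there x∈) = ≤-trans (∈⇒≤foldr⊔ g x∈) (m≤n⊔m (g y) _)

lookup≤vsum : ∀ {k} (v : Vec ℕ k) i → lookup v i ≤ vsum v
lookup≤vsum (x ∷ xs) F.zero    = m≤m+n x (vsum xs)
lookup≤vsum (x ∷ xs) (F.suc i) = ≤-trans (lookup≤vsum xs i) (m≤n+m (vsum xs) x)

∈-boundedVecs : ∀ {k} b (v : Vec ℕ k) → (∀ i → lookup v i ≤ b) → v ∈ boundedVecs k b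
∈-boundedVecs b []       _   = here refl
∈-boundedVecs {suc k} b (x ∷ xs) v≤b =
  ∈-concatMap⁺ (λ y → map (y ∷_) (boundedVecs k b))
    (Any.map (λ { refl → ∈-map⁺ (x ∷_) (∈-boundedVecs b xs (λ i → v≤b (F.suc i))) })
      (∈-upTo⁺ (s≤s (v≤b F.zero))))

∈-𝒱 : ∀ {k m} (v : Vec ℕ k) → vsum v ≡ m → v ∈ 𝒱 k m
∈-𝒱 {m = m} v Σv≡m =
  ∈-filter⁺ (λ w → T? (vsum w ≡ᵇ m))
    (∈-boundedVecs m v (λ i → subst (lookup v i ≤_) Σv≡m (lookup≤vsum v i)))
    (≡⇒≡ᵇ (vsum v) m Σv≡m)

below-with-vsum : ∀ {k} m (u : Vec ℕ k) → m ≤ vsum u →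
                  ∃[ v ] vsum v ≡ m × (∀ i → lookup v i ≤ lookup u i)
below-with-vsum m []       m≤0 = [] , sym (n≤0⇒n≡0 m≤0) , λ ()
below-with-vsum m (x ∷ xs) m≤Σ
  with v , Σv≡m∸x , v≤xs ← below-with-vsum (m ∸ x) xs (m≤n+o⇒m∸n≤o m x m≤Σ) =
  (x ⊓ m) ∷ v , trans (cong (x ⊓ m +_) Σv≡m∸x) (m⊓n+n∸m≡n x m) , below
  where
  below : ∀ i → lookup ((x ⊓ m) ∷ v) i ≤ lookup (x ∷ xs) i
  below F.zero    = m⊓n≤m x m
  below (F.suc i) = v≤xs i

k*c≤vsum+vsum-∸ : ∀ {k} c (w : Vec ℕ k) → k * c ≤ vsum w + vsum (V.map (c ∸_) w)
k*c≤vsum+vsum-∸ c []       = z≤n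
k*c≤vsum+vsum-∸ {suc k} c (x ∷ xs) = begin
    c + k * c
  ≤⟨ +-mono-≤ (m≤n+m∸n c x) (k*c≤vsum+vsum-∸ c xs) ⟩
    (x + (c ∸ x)) + (vsum xs + vsum (V.map (c ∸_) xs))
  ≡⟨ interchange x (c ∸ x) (vsum xs) (vsum (V.map (c ∸_) xs)) ⟩
    (x + vsum xs) + ((c ∸ x) + vsum (V.map (c ∸_) xs))
  ∎
  where
  open ≤-Reasoning

sum-map-tabulate : ∀ {k} {A : Set} (g : A → ℕ) (h : Fin k → A) →
                   sum (map g (L.tabulate h)) ≡ vsum (V.tabulate (λ i → g (h i)))
sum-map-tabulate {zero}  g h = refl
sum-map-tabulate {suc k} g h = cong (g (h F.zero) +_) (sum-map-tabulate g (λ i → h (F.suc i)))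

m∸o≤n⇒m∸n≤o : ∀ m n o → m ∸ o ≤ n → m ∸ n ≤ o
m∸o≤n⇒m∸n≤o m n o m∸o≤n =
  m≤n+o⇒m∸n≤o m n (≤-trans (m≤n+m∸n m o) (≤-trans (+-monoʳ-≤ o m∸o≤n) (≤-reflexive (+-comm o n))))

module _ {k p n : ℕ} (e : Vec ℕ k → Fin n) (i : Fin k) (S : Fin n → Bool) where

  private
    Vs : List (Vec ℕ k)
    Vs = 𝒱 k (p * k ∸ k + 1)

    meets-Z : Vec ℕ k → Bool
    meets-Z w = S (e w) ∧ (lookup w i ≡ᵇ 0)

  f-meets-Z : ∀ {v} → v ∈ Vs → S (e v) ≡ true → lookup v i ≡ 0 → f k p n e i S ≡ 2 * p * k + 1
  f-meets-Z {v} v∈ eᵥ∈S vᵢ≡0 with any meets-Z Vs | any⁺ meets-Z (lose v∈ hit)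
    where
    hit : T (meets-Z v)
    hit = subst T (sym (cong₂ _∧_ eᵥ∈S (cong (_≡ᵇ 0) vᵢ≡0))) _
  ... | true  | _  = refl
  ... | false | ()

  f-meets-N : ∀ {v t} → v ∈ Vs → S (e v) ≡ true → lookup v i ≡ suc t → 2 * p ∸ t ≤ f k p n e i S
  f-meets-N {v} {t} v∈ eᵥ∈S vᵢ≡1+t with any meets-Z Vs
  ... | true  = ≤-trans (m∸n≤m (2 * p) t)
                  (≤-trans (m≤m*n (2 * p) k {{nonZeroIndex i}}) (m≤m+n (2 * p * k) 1))
  ... | false = ≤-trans (≤-reflexive term-at-v) (∈⇒≤foldr⊔ _ v∈)
    where
    term-at-v : 2 * p ∸ t ≡ (if S (e v) ∧ (0 <ᵇ lookup v i) then (2 * p + 1) ∸ lookup v i else 0)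
    term-at-v rewrite eᵥ∈S | vᵢ≡1+t = cong (_∸ suc t) (+-comm 1 (2 * p))

part-at-self : ∀ {n k} (part : Fin n → Fin k) x → part-at part (part x) x ≡ true
part-at-self part x with part x F.≟ part x
... | yes _   = refl
... | no x≢x = contradiction refl x≢x

module Partition {k p n : ℕ} (e : Vec ℕ k → Fin n) (part : Fin n → Fin k) where

  values : Vec ℕ k
  values = V.tabulate (λ i → f k p n e i (part-at part i))

  slack : Vec ℕ k
  slack = V.map (2 * p ∸_) values

  total≡vsum-values : total k p n e part ≡ vsum values
  total≡vsum-values = sum-map-tabulate (λ i → f k p n e i (part-at part i)) (λ i → i)

  lookup-values : ∀ i → lookup values i ≡ f k p n e i (part-at part i)
  lookup-values = lookup∘tabulate _

  lookup-slack : ∀ i → lookup slack i ≡ 2 * p ∸ f k p n e i (part-at part i)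
  lookup-slack i = trans (lookup-map i (2 * p ∸_) values) (cong (2 * p ∸_) (lookup-values i))

  below-slack⇒meets-Z : ∀ {v} j → v ∈ 𝒱 k (p * k ∸ k + 1) → (∀ i → lookup v i ≤ lookup slack i) →
                        part-at part j (e v) ≡ true → f k p n e j (part-at part j) ≡ 2 * p * k + 1
  below-slack⇒meets-Z {v} j v∈𝒱 v≤slack eᵥ∈Xⱼ with lookup v j in vⱼ≡
  ... | zero  = f-meets-Z {p = p} e j (part-at part j) v∈𝒱 eᵥ∈Xⱼ vⱼ≡
  ... | suc t = contradiction 1+t≤t 1+n≰n
    where
    open ≤-Reasoning
    1+t≤t : suc t ≤ t
    1+t≤t = begin
      suc t                                  ≡⟨ vⱼ≡ ⟨
      lookup v j                             ≤⟨ v≤slack j ⟩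
      lookup slack j                         ≡⟨ lookup-slack j ⟩
      2 * p ∸ f k p n e j (part-at part j)   ≤⟨ m∸o≤n⇒m∸n≤o (2 * p) _ t
                                                  (f-meets-N {p = p} e j (part-at part j) v∈𝒱 eᵥ∈Xⱼ vⱼ≡) ⟩
      t                                      ∎

  large-slack⇒meets-Z : p * k ∸ k + 1 ≤ vsum slack →
                        ∃[ j ] f k p n e j (part-at part j) ≡ 2 * p * k + 1
  large-slack⇒meets-Z m≤Σ with v , Σv≡m , v≤slack ← below-with-vsum _ slack m≤Σ =
    part (e v) , below-slack⇒meets-Z (part (e v)) (∈-𝒱 v Σv≡m) v≤slack (part-at-self part (e v))

lemma7 : (k n p : ℕ) → 2 ≤ k → k ≤ ⌊log₂ n ⌋ →
    1 ≤ p → p * k ≤ ⌊log₂ n ⌋ → ⌊log₂ n ⌋ ≤ (p + 1) * k ∸ 1 →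
    (e : Vec ℕ k → Fin n) →
    (∀ v w → inV (p * k ∸ k + 1) v → inV (p * k ∸ k + 1) w → e v ≡ e w → v ≡ w) →
    (part : Fin n → Fin k) →
    p * k + k ≤ total k p n e part
lemma7 k n p _ _ 1≤p _ _ e _ part =
  subst (p * k + k ≤_) (sym total≡vsum-values) bound
  where
  open Partition {p = p} e part
  open ≤-Reasoning

  k≤pk : k ≤ p * k
  k≤pk = m≤n*m k p {{>-nonZero 1≤p}}

  double-pk : 2 * p * k ≡ p * k + p * k
  double-pk = trans (*-assoc 2 p k) (cong (p * k +_) (+-identityʳ (p * k)))

  bound : p * k + k ≤ vsum values
  bound with p * k ∸ k + 1 ≤? vsum slack
  ... | yes m≤Σ with j , fⱼ≡ ← large-slack⇒meets-Z m≤Σ = begin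
      p * k + k              ≤⟨ +-monoʳ-≤ (p * k) k≤pk ⟩
      p * k + p * k          ≡⟨ double-pk ⟨
      2 * p * k              ≤⟨ m≤m+n (2 * p * k) 1 ⟩
      2 * p * k + 1          ≡⟨ trans (sym fⱼ≡) (sym (lookup-values j)) ⟩
      lookup values j        ≤⟨ lookup≤vsum values j ⟩
      vsum values            ∎
  ... | no m≰Σ = +-cancelʳ-≤ (vsum slack) _ _ (begin
      p * k + k + vsum slack      ≡⟨ +-assoc (p * k) k _ ⟩
      p * k + (k + vsum slack)    ≡⟨ cong (p * k +_) (+-comm k _) ⟩
      p * k + (vsum slack + k)    ≤⟨ +-monoʳ-≤ (p * k) small-slack ⟩
      p * k + p * k               ≡⟨ double-pk ⟨
      2 * p * k                   ≡⟨ *-comm (2 * p) k ⟩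
      k * (2 * p)                 ≤⟨ k*c≤vsum+vsum-∸ (2 * p) values ⟩
      vsum values + vsum slack    ∎)
    where
    small-slack : vsum slack + k ≤ p * k
    small-slack = m≤o∸n⇒m+n≤o (vsum slack) k≤pk
                    (m<1+n⇒m≤n (subst (vsum slack <_) (+-comm _ 1) (≰⇒> m≰Σ)))
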